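{- For any integers $k$, $l$, $m$ with $0\leq l\leq k\leq m$, \[ S_3(m+k+l)+S_3(m-k)+S_3(m-l)-3S_3(m)\leq 2k+l. \]
   Context: $s_3(n)$ denotes the sum of the ternary (base $3$) digits of the nonnegative integer $n$, and $S_3(N)=\sum_{n=0}^{N-1}s_3(n)$ for $N\in\mathbb{Z}_{\ge0}$ (so $S_3(0)=0$). -}

module Defs where

open import Data.Nat using (ℕ; zero; suc; _+_; _*_; _/_; _%_)

-- ternary digit sum, computed with fuel (fuel ≥ n suffices, since n / 3 < n for n > 0)
s3-fuel : ℕ → ℕ → ℕ
s3-fuel zero    n = 0
s3-fuel (suc f) zero = 0
s3-fuel (suc f) n@(suc _) = n % 3 + s3-fuel f (n / 3)

s3 : ℕ → ℕ
s3 n = s3-fuel n n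

S3 : ℕ → ℕ
S3 zero    = 0
S3 (suc N) = S3 N + s3 N

module Submission where

-- The theorem is a special case of an inequality for arbitrary a, b, c,
--   S₃(a) + S₃(b) + S₃(c) + (a + b + c) ≤ S₃(a + b + c) + (|a−b| + |b−c| + |a−c|) / 2,
-- stated doubled as `Balanced a b c`: for a + b + c = 3m one subtracts S₃(3m) = 3 S₃(m) + 3m,
-- and the triple (m+k+l, m−k, m−l) has pairwise distances summing to 2(2k + l).
--
-- `Balanced` is proved by strong induction on a + b + c. Writing a = 3A + i, b = 3B + j, c = 3C + k,
-- the i + j + k last digits are dealt cyclically to three slots, which replaces (a, b, c) by the three
-- smaller triples (A + αₛ, B + βₛ, C + γₛ) with αₛ, βₛ, γₛ ∈ {0,1}. Two general facts drive the step:
-- the block identity S₃(3Y + e₀ + e₁ + e₂) = Σₛ S₃(Y + eₛ) + 3Y + T(e₀ + e₁ + e₂), T triangular, and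
-- the bound on how much distances grow when split slotwise. The step (module Step) works for any
-- dealing satisfying a finite inequality (`Cost`); for the cyclic dealing this inequality, like the
-- base case a, b, c < 3, is checked by evaluation on all 27 triples of digits.

open import Defs
open import Data.Nat using (ℕ; _≤_; _∸_; _+_)
open import Data.Integer using (ℤ; +_) renaming (_+_ to _+ℤ_; _-_ to _-ℤ_; _*_ to _*ℤ_; _≤_ to _≤ℤ_)

open import Data.Nat using (zero; suc; _*_; _<_; _/_; _%_; _<ᵇ_; _≟_; _≤?_; s≤s; z≤n; ∣_-_∣)
open import Data.Nat.Properties
open import Data.Nat.DivMod
open import Data.Bool using (Bool; true; false)
open import Data.Fin using (Fin; toℕ)
open import Data.Fin.Patterns using (0F; 1F; 2F)
open import Data.Fin.Properties using (all?)
open import Data.Product using (_×_; _,_; proj₁; proj₂; ∃₂)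
open import Relation.Nullary.Decidable using (Dec; True; toWitness; _×-dec_)
open import Data.Nat.Induction using (<-rec)
open import Function using (id)
open import Relation.Binary.PropositionalEquality
open import Relation.Binary using (tri<; tri≈; tri>)
open import Data.Nat.Tactic.RingSolver using (solve-∀)
open import Data.Integer using (_⊖_)
import Data.Integer.Properties as ℤ

s3-fuel-irrelevant : ∀ f g n → n ≤ f → n ≤ g → s3-fuel f n ≡ s3-fuel g n
s3-fuel-irrelevant f g zero _ _ = trans (s3-fuel-zero f) (sym (s3-fuel-zero g))
  where
  s3-fuel-zero : ∀ f → s3-fuel f 0 ≡ 0
  s3-fuel-zero zero    = refl
  s3-fuel-zero (suc f) = refl
s3-fuel-irrelevant (suc f) (suc g) n@(suc k) (s≤s k≤f) (s≤s k≤g) =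
  cong (_+_ (n % 3)) (s3-fuel-irrelevant f g (n / 3) (≤-trans (suc/3≤ k) k≤f) (≤-trans (suc/3≤ k) k≤g))
  where
  suc/3≤ : ∀ k → suc k / 3 ≤ k
  suc/3≤ k = ≤-pred (m/n<m (suc k) 3 (s≤s (s≤s z≤n)))

s3-unfold : ∀ n → s3 n ≡ n % 3 + s3 (n / 3)
s3-unfold zero      = refl
s3-unfold n@(suc k) = cong (_+_ (n % 3)) (s3-fuel-irrelevant k (n / 3) (n / 3) n/3≤k ≤-refl)
  where
  n/3≤k : n / 3 ≤ k
  n/3≤k = ≤-pred (m/n<m n 3 (s≤s (s≤s z≤n)))

s3-digit : ∀ Y r → r < 3 → s3 (3 * Y + r) ≡ r + s3 Y
s3-digit Y r r<3 = begin
  s3 (3 * Y + r)                         ≡⟨ s3-unfold (3 * Y + r) ⟩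
  (3 * Y + r) % 3 + s3 ((3 * Y + r) / 3) ≡⟨ cong₂ (λ u v → u % 3 + s3 (v / 3)) swap swap ⟩
  (r + Y * 3) % 3 + s3 ((r + Y * 3) / 3) ≡⟨ cong₂ (λ u v → u + s3 v) remainder quotient ⟩
  r + s3 Y                               ∎
  where
  open ≡-Reasoning
  swap : 3 * Y + r ≡ r + Y * 3
  swap = trans (+-comm (3 * Y) r) (cong (_+_ r) (*-comm 3 Y))
  r%3≡r : r % 3 ≡ r
  r%3≡r = m<n⇒m%n≡m r<3
  remainder : (r + Y * 3) % 3 ≡ r
  remainder = trans ([m+kn]%n≡m%n r Y 3) r%3≡r
  quotient : (r + Y * 3) / 3 ≡ Y
  quotient = begin
    (r + Y * 3) / 3     ≡⟨ +-distrib-/ r (Y * 3) no-carry ⟩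
    r / 3 + Y * 3 / 3   ≡⟨ cong₂ _+_ (m<n⇒m/n≡0 r<3) (m*n/n≡m Y 3) ⟩
    Y                   ∎
    where
    no-carry : r % 3 + Y * 3 % 3 < 3
    no-carry = subst (_< 3) (sym (trans (cong (_+_ (r % 3)) (m*n%n≡0 Y 3)) (trans (+-identityʳ _) r%3≡r))) r<3

triangle : ℕ → ℕ
triangle zero    = 0
triangle (suc c) = c + triangle c

-- The numbers 3Y, …, 3Y + c − 1 (c ≤ 3) all end in Y, and their last digits sum to T(c).
S3-block : ∀ Y c → c ≤ 3 → S3 (3 * Y + c) ≡ S3 (3 * Y) + (c * s3 Y + triangle c)
S3-block Y zero    _         = trans (cong S3 (+-identityʳ (3 * Y))) (sym (+-identityʳ _))
S3-block Y (suc c) (s≤s c≤2) = begin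
  S3 (3 * Y + suc c)                                   ≡⟨ cong S3 (+-suc (3 * Y) c) ⟩
  S3 (3 * Y + c) + s3 (3 * Y + c)                      ≡⟨ cong₂ _+_ (S3-block Y c (m≤n⇒m≤1+n c≤2)) (s3-digit Y c (s≤s c≤2)) ⟩
  S3 (3 * Y) + (c * s3 Y + triangle c) + (c + s3 Y)    ≡⟨ regroup (S3 (3 * Y)) c (s3 Y) (triangle c) ⟩
  S3 (3 * Y) + (suc c * s3 Y + triangle (suc c))       ∎
  where
  open ≡-Reasoning
  regroup : ∀ S c x t → S + (c * x + t) + (c + x) ≡ S + ((x + c * x) + (c + t))
  regroup = solve-∀

-- S₃(3Y) = 3 S₃(Y) + 3Y: the numbers below 3Y are 3n + r with n < Y, r < 3.
S3-triple : ∀ Y → S3 (3 * Y) ≡ 3 * S3 Y + 3 * Y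
S3-triple zero    = refl
S3-triple (suc Y) = begin
  S3 (3 * suc Y)                           ≡⟨ cong S3 (trans (*-suc 3 Y) (+-comm 3 (3 * Y))) ⟩
  S3 (3 * Y + 3)                           ≡⟨ S3-block Y 3 ≤-refl ⟩
  S3 (3 * Y) + (3 * s3 Y + 3)              ≡⟨ cong (_+ (3 * s3 Y + 3)) (S3-triple Y) ⟩
  3 * S3 Y + 3 * Y + (3 * s3 Y + 3)        ≡⟨ regroup (S3 Y) (s3 Y) Y ⟩
  3 * (S3 Y + s3 Y) + 3 * suc Y            ∎
  where
  open ≡-Reasoning
  regroup : ∀ S x Y → 3 * S + 3 * Y + (3 * x + 3) ≡ 3 * (S + x) + 3 * suc Y
  regroup = solve-∀

Σ₃ : (Fin 3 → ℕ) → ℕ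
Σ₃ f = f 0F + f 1F + f 2F

Σ₃-cong : ∀ {f g} → (∀ s → f s ≡ g s) → Σ₃ f ≡ Σ₃ g
Σ₃-cong f≡g = cong₂ _+_ (cong₂ _+_ (f≡g 0F) (f≡g 1F)) (f≡g 2F)

Σ₃-mono : ∀ {f g} → (∀ s → f s ≤ g s) → Σ₃ f ≤ Σ₃ g
Σ₃-mono f≤g = +-mono-≤ (+-mono-≤ (f≤g 0F) (f≤g 1F)) (f≤g 2F)

Σ₃-+ : ∀ f g → Σ₃ (λ s → f s + g s) ≡ Σ₃ f + Σ₃ g
Σ₃-+ f g = regroup (f 0F) (f 1F) (f 2F) (g 0F) (g 1F) (g 2F)
  where
  regroup : ∀ a b c x y z → (a + x) + (b + y) + (c + z) ≡ (a + b + c) + (x + y + z)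
  regroup = solve-∀

Σ₃-*ˡ : ∀ n f → Σ₃ (λ s → n * f s) ≡ n * Σ₃ f
Σ₃-*ˡ n f = sym (trans (*-distribˡ-+ n (f 0F + f 1F) (f 2F)) (cong (_+ n * f 2F) (*-distribˡ-+ n (f 0F) (f 1F))))

Σ₃-shift : ∀ n f → Σ₃ (λ s → n + f s) ≡ 3 * n + Σ₃ f
Σ₃-shift n f = regroup n (f 0F) (f 1F) (f 2F)
  where
  regroup : ∀ n a b c → (n + a) + (n + b) + (n + c) ≡ 3 * n + (a + b + c)
  regroup = solve-∀

Σ₃-≥ : ∀ f s → f s ≤ Σ₃ f
Σ₃-≥ f 0F = ≤-trans (m≤m+n (f 0F) (f 1F)) (m≤m+n _ (f 2F))
Σ₃-≥ f 1F = ≤-trans (m≤n+m (f 1F) (f 0F)) (m≤m+n _ (f 2F))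
Σ₃-≥ f 2F = m≤n+m (f 2F) _

Σ₃-∸ : ∀ f g → (∀ s → g s ≤ f s) → Σ₃ (λ s → f s ∸ g s) ≡ Σ₃ f ∸ Σ₃ g
Σ₃-∸ f g g≤f = begin
  Σ₃ (λ s → f s ∸ g s)                       ≡⟨ m+n∸n≡m _ (Σ₃ g) ⟨
  Σ₃ (λ s → f s ∸ g s) + Σ₃ g ∸ Σ₃ g         ≡⟨ cong (_∸ Σ₃ g) (Σ₃-+ (λ s → f s ∸ g s) g) ⟨
  Σ₃ (λ s → f s ∸ g s + g s) ∸ Σ₃ g          ≡⟨ cong (_∸ Σ₃ g) (Σ₃-cong (λ s → m∸n+n≡m (g≤f s))) ⟩
  Σ₃ f ∸ Σ₃ g                                ∎
  where open ≡-Reasoning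

Bits : Set
Bits = Fin 3 → Bool

bit : Bool → ℕ
bit false = 0
bit true  = 1

bit≤1 : ∀ e → bit e ≤ 1
bit≤1 false = z≤n
bit≤1 true  = ≤-refl

count : Bits → ℕ
count e = Σ₃ (λ s → bit (e s))

count≤3 : ∀ e → count e ≤ 3
count≤3 e = Σ₃-mono (λ s → bit≤1 (e s))

S3-+bit : ∀ Y e → S3 (Y + bit e) ≡ S3 Y + bit e * s3 Y
S3-+bit Y false = trans (cong S3 (+-identityʳ Y)) (sym (+-identityʳ (S3 Y)))
S3-+bit Y true  = trans (cong S3 (+-comm Y 1)) (cong (_+_ (S3 Y)) (sym (+-identityʳ (s3 Y))))

S3-split : ∀ Y e → S3 (3 * Y + count e) ≡ Σ₃ (λ s → S3 (Y + bit (e s))) + 3 * Y + triangle (count e)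
S3-split Y e = begin
  S3 (3 * Y + count e)                                        ≡⟨ S3-block Y (count e) (count≤3 e) ⟩
  S3 (3 * Y) + (count e * s3 Y + triangle (count e))          ≡⟨ cong (_+ (count e * s3 Y + triangle (count e))) (S3-triple Y) ⟩
  3 * S3 Y + 3 * Y + (count e * s3 Y + triangle (count e))    ≡⟨ regroup (S3 Y) Y (count e * s3 Y) (triangle (count e)) ⟩
  3 * S3 Y + count e * s3 Y + 3 * Y + triangle (count e)      ≡⟨ cong (λ v → v + 3 * Y + triangle (count e)) split-blocks ⟨
  Σ₃ (λ s → S3 (Y + bit (e s))) + 3 * Y + triangle (count e)  ∎
  where
  open ≡-Reasoning
  regroup : ∀ S Y x t → 3 * S + 3 * Y + (x + t) ≡ 3 * S + x + 3 * Y + t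
  regroup = solve-∀
  split-blocks : Σ₃ (λ s → S3 (Y + bit (e s))) ≡ 3 * S3 Y + count e * s3 Y
  split-blocks = begin
    Σ₃ (λ s → S3 (Y + bit (e s)))                 ≡⟨ Σ₃-cong (λ s → S3-+bit Y (e s)) ⟩
    Σ₃ (λ s → S3 Y + bit (e s) * s3 Y)            ≡⟨ Σ₃-shift (S3 Y) (λ s → bit (e s) * s3 Y) ⟩
    3 * S3 Y + Σ₃ (λ s → bit (e s) * s3 Y)        ≡⟨ cong (_+_ (3 * S3 Y)) (Σ₃-cong (λ s → *-comm (bit (e s)) (s3 Y))) ⟩
    3 * S3 Y + Σ₃ (λ s → s3 Y * bit (e s))        ≡⟨ cong (_+_ (3 * S3 Y)) (trans (Σ₃-*ˡ (s3 Y) (λ s → bit (e s))) (*-comm (s3 Y) (count e))) ⟩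
    3 * S3 Y + count e * s3 Y                     ∎

defect : Bits → Bits → ℕ
defect e h = Σ₃ (λ s → ∣ bit (e s) - bit (h s) ∣) ∸ ∣ count e - count h ∣

-- If V < U then every slot U + eₛ lies above V + hₛ, so the slotwise distances add up exactly.
distance-split-> : ∀ U V e h → V < U →
  Σ₃ (λ s → ∣ U + bit (e s) - V + bit (h s) ∣) ≡ ∣ 3 * U + count e - 3 * V + count h ∣
distance-split-> U V e h V<U = begin
  Σ₃ (λ s → ∣ U + bit (e s) - V + bit (h s) ∣)           ≡⟨ Σ₃-cong (λ s → m≤n⇒∣n-m∣≡n∸m (ordered s)) ⟩
  Σ₃ (λ s → U + bit (e s) ∸ (V + bit (h s)))           ≡⟨ Σ₃-∸ (λ s → U + bit (e s)) (λ s → V + bit (h s)) ordered ⟩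
  Σ₃ (λ s → U + bit (e s)) ∸ Σ₃ (λ s → V + bit (h s)) ≡⟨ cong₂ _∸_ (Σ₃-shift U (λ s → bit (e s))) (Σ₃-shift V (λ s → bit (h s))) ⟩
  3 * U + count e ∸ (3 * V + count h)                  ≡⟨ m≤n⇒∣n-m∣≡n∸m ordered-sums ⟨
  ∣ 3 * U + count e - 3 * V + count h ∣                ∎
  where
  open ≡-Reasoning
  ordered : ∀ s → V + bit (h s) ≤ U + bit (e s)
  ordered s = ≤-trans (+-monoʳ-≤ V (bit≤1 (h s))) (≤-trans (subst (_≤ U) (+-comm 1 V) V<U) (m≤m+n U (bit (e s))))
  ordered-sums : 3 * V + count h ≤ 3 * U + count e
  ordered-sums = subst₂ _≤_ (Σ₃-shift V (λ s → bit (h s))) (Σ₃-shift U (λ s → bit (e s))) (Σ₃-mono ordered)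

distance-split : ∀ U V e h →
  Σ₃ (λ s → ∣ U + bit (e s) - V + bit (h s) ∣) ≤ ∣ 3 * U + count e - 3 * V + count h ∣ + defect e h
distance-split U V e h with <-cmp U V
... | tri> _ _ V<U = ≤-trans (≤-reflexive (distance-split-> U V e h V<U)) (m≤m+n _ _)
... | tri< U<V _ _ = ≤-trans (≤-reflexive swapped) (m≤m+n _ _)
  where
  open ≡-Reasoning
  swapped : Σ₃ (λ s → ∣ U + bit (e s) - V + bit (h s) ∣) ≡ ∣ 3 * U + count e - 3 * V + count h ∣
  swapped = begin
    Σ₃ (λ s → ∣ U + bit (e s) - V + bit (h s) ∣) ≡⟨ Σ₃-cong (λ s → ∣-∣-comm (U + bit (e s)) (V + bit (h s))) ⟩
    Σ₃ (λ s → ∣ V + bit (h s) - U + bit (e s) ∣) ≡⟨ distance-split-> V U h e U<V ⟩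
    ∣ 3 * V + count h - 3 * U + count e ∣        ≡⟨ ∣-∣-comm (3 * V + count h) (3 * U + count e) ⟩
    ∣ 3 * U + count e - 3 * V + count h ∣        ∎
... | tri≈ _ refl _ = begin
  Σ₃ (λ s → ∣ U + bit (e s) - U + bit (h s) ∣)       ≡⟨ Σ₃-cong (λ s → ∣m+n-m+o∣≡∣n-o∣ U (bit (e s)) (bit (h s))) ⟩
  Σ₃ (λ s → ∣ bit (e s) - bit (h s) ∣)               ≤⟨ m≤n+m∸n _ ∣ count e - count h ∣ ⟩
  ∣ count e - count h ∣ + defect e h                 ≡⟨ cong (_+ defect e h) (∣m+n-m+o∣≡∣n-o∣ (3 * U) (count e) (count h)) ⟨
  ∣ 3 * U + count e - 3 * U + count h ∣ + defect e h ∎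
  where open ≤-Reasoning

-- Sum of the pairwise distances of a, b, c (twice the gap between the largest and the smallest).
spread : ℕ → ℕ → ℕ → ℕ
spread a b c = ∣ a - b ∣ + ∣ b - c ∣ + ∣ a - c ∣

-- S₃(a) + S₃(b) + S₃(c) + (a + b + c) ≤ S₃(a + b + c) + spread/2, doubled to stay in ℕ.
Balanced : ℕ → ℕ → ℕ → Set
Balanced a b c = 2 * (S3 a + S3 b + S3 c + (a + b + c)) ≤ 2 * S3 (a + b + c) + spread a b c

Slots : Bits → Bits → Bits → ℕ → Bits → Set
Slots α β γ q g = ∀ s → bit (α s) + bit (β s) + bit (γ s) ≡ q + bit (g s)

-- The finite inequality that lets the induction step close.
Cost : Bits → Bits → Bits → ℕ → Bits → Set
Cost α β γ q g =
  defect α β + defect β γ + defect α γ + 2 * (triangle (count α) + triangle (count β) + triangle (count γ))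
    ≤ 2 * (3 * q + triangle (count g))

-- A way of dealing the last digits #α, #β, #γ of three numbers out to three slots.
record Dealing : Set where
  field
    α β γ g : Bits
    q       : ℕ
    slots   : Slots α β γ q g
    cost    : Cost α β γ q g

module Step (D : Dealing) (A B C : ℕ) where
  open Dealing D

  a b c : ℕ
  a = 3 * A + count α
  b = 3 * B + count β
  c = 3 * C + count γ

  aₛ bₛ cₛ xₛ : Fin 3 → ℕ
  aₛ s = A + bit (α s)
  bₛ s = B + bit (β s)
  cₛ s = C + bit (γ s)
  xₛ s = aₛ s + bₛ s + cₛ s

  Y : ℕ
  Y = A + B + C + q

  slot-total : ∀ s → xₛ s ≡ Y + bit (g s)
  slot-total s = begin
    xₛ s                                             ≡⟨ regroup A B C (bit (α s)) (bit (β s)) (bit (γ s)) ⟩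
    A + B + C + (bit (α s) + bit (β s) + bit (γ s))  ≡⟨ cong (_+_ (A + B + C)) (slots s) ⟩
    A + B + C + (q + bit (g s))                      ≡⟨ +-assoc (A + B + C) q (bit (g s)) ⟨
    Y + bit (g s)                                    ∎
    where
    open ≡-Reasoning
    regroup : ∀ A B C x y z → (A + x) + (B + y) + (C + z) ≡ A + B + C + (x + y + z)
    regroup = solve-∀

  slots-sum : Σ₃ xₛ ≡ a + b + c
  slots-sum = trans (Σ₃-+ (λ s → aₛ s + bₛ s) cₛ)
    (cong₂ _+_ (trans (Σ₃-+ aₛ bₛ) (cong₂ _+_ (Σ₃-shift A (λ s → bit (α s))) (Σ₃-shift B (λ s → bit (β s)))))
                (Σ₃-shift C (λ s → bit (γ s))))

  total : a + b + c ≡ 3 * Y + count g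
  total = trans (sym slots-sum) (trans (Σ₃-cong slot-total) (Σ₃-shift Y (λ s → bit (g s))))

  slot-smaller : 1 ≤ A + B + C → ∀ s → xₛ s < a + b + c
  slot-smaller 1≤ABC s = begin-strict
    xₛ s              ≡⟨ slot-total s ⟩
    Y + bit (g s)     ≤⟨ +-monoʳ-≤ Y (Σ₃-≥ (λ s → bit (g s)) s) ⟩
    Y + count g       <⟨ +-monoˡ-< (count g) (m<m+n Y (≤-trans 1≤Y (m≤m+n Y _))) ⟩
    3 * Y + count g   ≡⟨ total ⟨
    a + b + c         ∎
    where
    open ≤-Reasoning
    1≤Y : 1 ≤ Y
    1≤Y = ≤-trans 1≤ABC (m≤m+n (A + B + C) q)

  L : Fin 3 → ℕ
  L s = S3 (aₛ s) + S3 (bₛ s) + S3 (cₛ s)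

  T : ℕ
  T = triangle (count α) + triangle (count β) + triangle (count γ)

  E : ℕ
  E = defect α β + defect β γ + defect α γ

  spreadₛ : Fin 3 → ℕ
  spreadₛ s = spread (aₛ s) (bₛ s) (cₛ s)

  digit-sums : S3 a + S3 b + S3 c ≡ Σ₃ L + 3 * (A + B + C) + T
  digit-sums = begin
    S3 a + S3 b + S3 c
      ≡⟨ cong₂ _+_ (cong₂ _+_ (S3-split A α) (S3-split B β)) (S3-split C γ) ⟩
    (Σ₃ (λ s → S3 (aₛ s)) + 3 * A + triangle (count α)) + (Σ₃ (λ s → S3 (bₛ s)) + 3 * B + triangle (count β))
      + (Σ₃ (λ s → S3 (cₛ s)) + 3 * C + triangle (count γ))
      ≡⟨ regroup (Σ₃ (λ s → S3 (aₛ s))) (Σ₃ (λ s → S3 (bₛ s))) (Σ₃ (λ s → S3 (cₛ s))) A B C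
                 (triangle (count α)) (triangle (count β)) (triangle (count γ)) ⟩
    Σ₃ (λ s → S3 (aₛ s)) + Σ₃ (λ s → S3 (bₛ s)) + Σ₃ (λ s → S3 (cₛ s)) + 3 * (A + B + C) + T
      ≡⟨ cong (λ v → v + 3 * (A + B + C) + T) sum-L ⟨
    Σ₃ L + 3 * (A + B + C) + T ∎
    where
    open ≡-Reasoning
    regroup : ∀ x y z A B C t u v → (x + 3 * A + t) + (y + 3 * B + u) + (z + 3 * C + v)
                                    ≡ x + y + z + 3 * (A + B + C) + (t + u + v)
    regroup = solve-∀
    sum-L : Σ₃ L ≡ Σ₃ (λ s → S3 (aₛ s)) + Σ₃ (λ s → S3 (bₛ s)) + Σ₃ (λ s → S3 (cₛ s))
    sum-L = trans (Σ₃-+ (λ s → S3 (aₛ s) + S3 (bₛ s)) (λ s → S3 (cₛ s)))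
                  (cong (_+ Σ₃ (λ s → S3 (cₛ s))) (Σ₃-+ (λ s → S3 (aₛ s)) (λ s → S3 (bₛ s))))

  digit-sum-total : S3 (a + b + c) ≡ Σ₃ (λ s → S3 (xₛ s)) + 3 * Y + triangle (count g)
  digit-sum-total = trans (cong S3 total) (trans (S3-split Y g)
    (cong (λ v → v + 3 * Y + triangle (count g)) (Σ₃-cong (λ s → cong S3 (sym (slot-total s))))))

  spreads : Σ₃ spreadₛ ≤ spread a b c + E
  spreads = begin
    Σ₃ spreadₛ
      ≡⟨ trans (Σ₃-+ (λ s → ∣ aₛ s - bₛ s ∣ + ∣ bₛ s - cₛ s ∣) (λ s → ∣ aₛ s - cₛ s ∣))
               (cong (_+ Σ₃ (λ s → ∣ aₛ s - cₛ s ∣)) (Σ₃-+ (λ s → ∣ aₛ s - bₛ s ∣) (λ s → ∣ bₛ s - cₛ s ∣))) ⟩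
    Σ₃ (λ s → ∣ aₛ s - bₛ s ∣) + Σ₃ (λ s → ∣ bₛ s - cₛ s ∣) + Σ₃ (λ s → ∣ aₛ s - cₛ s ∣)
      ≤⟨ +-mono-≤ (+-mono-≤ (distance-split A B α β) (distance-split B C β γ)) (distance-split A C α γ) ⟩
    (∣ a - b ∣ + defect α β) + (∣ b - c ∣ + defect β γ) + (∣ a - c ∣ + defect α γ)
      ≡⟨ regroup ∣ a - b ∣ ∣ b - c ∣ ∣ a - c ∣ (defect α β) (defect β γ) (defect α γ) ⟩
    spread a b c + E ∎
    where
    open ≤-Reasoning
    regroup : ∀ x y z u v w → (x + u) + (y + v) + (z + w) ≡ (x + y + z) + (u + v + w)
    regroup = solve-∀

  -- Summing the hypotheses over the slots: the triangular corrections and the extra spread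
  -- of the slots are paid for by the cost condition.
  step : (∀ s → Balanced (aₛ s) (bₛ s) (cₛ s)) → Balanced a b c
  step ih = begin
    2 * (S3 a + S3 b + S3 c + (a + b + c))
      ≡⟨ cong₂ (λ u v → 2 * (u + v)) digit-sums (sym slots-sum) ⟩
    2 * (Σ₃ L + K + T + Σ₃ xₛ)
      ≡⟨ regroup₁ (Σ₃ L) K T (Σ₃ xₛ) ⟩
    2 * (Σ₃ L + Σ₃ xₛ) + (2 * K + 2 * T)
      ≡⟨ cong (_+ (2 * K + 2 * T)) (trans (Σ₃-*ˡ 2 (λ s → L s + xₛ s)) (cong (2 *_) (Σ₃-+ L xₛ))) ⟨
    Σ₃ (λ s → 2 * (L s + xₛ s)) + (2 * K + 2 * T)
      ≤⟨ +-monoˡ-≤ (2 * K + 2 * T) (Σ₃-mono ih) ⟩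
    Σ₃ (λ s → 2 * S3 (xₛ s) + spreadₛ s) + (2 * K + 2 * T)
      ≡⟨ cong (_+ (2 * K + 2 * T)) (trans (Σ₃-+ (λ s → 2 * S3 (xₛ s)) spreadₛ) (cong (_+ Σ₃ spreadₛ) (Σ₃-*ˡ 2 (λ s → S3 (xₛ s))))) ⟩
    2 * Sx + Σ₃ spreadₛ + (2 * K + 2 * T)
      ≤⟨ +-monoˡ-≤ (2 * K + 2 * T) (+-monoʳ-≤ (2 * Sx) spreads) ⟩
    2 * Sx + (spread a b c + E) + (2 * K + 2 * T)
      ≡⟨ regroup₂ Sx (spread a b c) E K T ⟩
    2 * Sx + spread a b c + 2 * K + (E + 2 * T)
      ≤⟨ +-monoʳ-≤ (2 * Sx + spread a b c + 2 * K) cost ⟩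
    2 * Sx + spread a b c + 2 * K + 2 * (3 * q + triangle (count g))
      ≡⟨ regroup₃ Sx (spread a b c) (A + B + C) q (triangle (count g)) ⟩
    2 * (Sx + 3 * Y + triangle (count g)) + spread a b c
      ≡⟨ cong (λ v → 2 * v + spread a b c) digit-sum-total ⟨
    2 * S3 (a + b + c) + spread a b c ∎
    where
    open ≤-Reasoning
    K : ℕ
    K = 3 * (A + B + C)
    Sx : ℕ
    Sx = Σ₃ (λ s → S3 (xₛ s))
    regroup₁ : ∀ l k t x → 2 * (l + k + t + x) ≡ 2 * (l + x) + (2 * k + 2 * t)
    regroup₁ = solve-∀
    regroup₂ : ∀ x d e k t → 2 * x + (d + e) + (2 * k + 2 * t) ≡ 2 * x + d + 2 * k + (e + 2 * t)
    regroup₂ = solve-∀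
    regroup₃ : ∀ x d n q t → 2 * x + d + 2 * (3 * n) + 2 * (3 * q + t) ≡ 2 * (x + 3 * (n + q) + t) + d
    regroup₃ = solve-∀

-- Deal r units around the slots starting at slot o: slot s gets a unit iff (s − o) mod 3 < r.
deal : ℕ → ℕ → Bits
deal o r s = (toℕ s + 2 * o) % 3 <ᵇ r

-- The last digits i, j, k are dealt one after another around the slots, starting at slot 0;
-- then every slot gets q = ⌊(i+j+k)/3⌋ units, and the first (i+j+k) mod 3 slots one more.
module Cyclic (i j k : Fin 3) where
  α β γ g : Bits
  α = deal 0 (toℕ i)
  β = deal (toℕ i) (toℕ j)
  γ = deal (toℕ i + toℕ j) (toℕ k)
  g = deal 0 ((toℕ i + toℕ j + toℕ k) % 3)

  q : ℕ
  q = (toℕ i + toℕ j + toℕ k) / 3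

check₃ : {P : Fin 3 → Fin 3 → Fin 3 → Set} (P? : ∀ i j k → Dec (P i j k)) →
         {_ : True (all? λ i → all? λ j → all? λ k → P? i j k)} → ∀ i j k → P i j k
check₃ P? {ok} = toWitness ok

cyclic-counts : ∀ i j k → let open Cyclic i j k in count α ≡ toℕ i × count β ≡ toℕ j × count γ ≡ toℕ k
cyclic-counts = check₃ (λ i j k → (_ ≟ _) ×-dec (_ ≟ _) ×-dec (_ ≟ _))

cyclic-slots : ∀ i j k → let open Cyclic i j k in Slots α β γ q g
cyclic-slots = check₃ (λ i j k → all? (λ s → _ ≟ _))

cyclic-cost : ∀ i j k → let open Cyclic i j k in Cost α β γ q g
cyclic-cost = check₃ (λ i j k → _ ≤? _)

cyclic : Fin 3 → Fin 3 → Fin 3 → Dealing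
cyclic i j k = record
  { α = α ; β = β ; γ = γ ; g = g ; q = q
  ; slots = cyclic-slots i j k ; cost = cyclic-cost i j k }
  where open Cyclic i j k

balanced-small : ∀ i j k → Balanced (toℕ i) (toℕ j) (toℕ k)
balanced-small = check₃ (λ i j k → _ ≤? _)

last-digit : ∀ n → ∃₂ λ N (r : Fin 3) → n ≡ 3 * N + toℕ r
last-digit n with n divMod 3
... | result N r n≡ = N , r , trans n≡ (trans (+-comm (toℕ r) (N * 3)) (cong (_+ toℕ r) (*-comm N 3)))

subst-balanced : ∀ {a b c a′ b′ c′} → a ≡ a′ → b ≡ b′ → c ≡ c′ → Balanced a b c → Balanced a′ b′ c′
subst-balanced refl refl refl = id

balanced-step : ∀ A B C (i j k : Fin 3) → 1 ≤ A + B + C →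
  (∀ a b c → a + b + c < (3 * A + toℕ i) + (3 * B + toℕ j) + (3 * C + toℕ k) → Balanced a b c) →
  Balanced (3 * A + toℕ i) (3 * B + toℕ j) (3 * C + toℕ k)
balanced-step A B C i j k 1≤ABC smaller =
  subst-balanced (cong (_+_ (3 * A)) #α) (cong (_+_ (3 * B)) #β) (cong (_+_ (3 * C)) #γ)
    (step (λ s → smaller (aₛ s) (bₛ s) (cₛ s) (subst (xₛ s <_) sums (slot-smaller 1≤ABC s))))
  where
  open Step (cyclic i j k) A B C
  #α : count (Cyclic.α i j k) ≡ toℕ i
  #α = proj₁ (cyclic-counts i j k)
  #β : count (Cyclic.β i j k) ≡ toℕ j
  #β = proj₁ (proj₂ (cyclic-counts i j k))
  #γ : count (Cyclic.γ i j k) ≡ toℕ k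
  #γ = proj₂ (proj₂ (cyclic-counts i j k))
  sums : a + b + c ≡ (3 * A + toℕ i) + (3 * B + toℕ j) + (3 * C + toℕ k)
  sums = cong₂ _+_ (cong₂ _+_ (cong (_+_ (3 * A)) #α) (cong (_+_ (3 * B)) #β)) (cong (_+_ (3 * C)) #γ)

balanced-from-digits : ∀ A B C (i j k : Fin 3) →
  (∀ a b c → a + b + c < (3 * A + toℕ i) + (3 * B + toℕ j) + (3 * C + toℕ k) → Balanced a b c) →
  Balanced (3 * A + toℕ i) (3 * B + toℕ j) (3 * C + toℕ k)
balanced-from-digits zero    zero    zero    i j k _ = balanced-small i j k
balanced-from-digits (suc A) B       C       i j k   = balanced-step (suc A) B C i j k (s≤s z≤n)
balanced-from-digits zero    (suc B) C       i j k   = balanced-step zero (suc B) C i j k (s≤s z≤n)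
balanced-from-digits zero    zero    (suc C) i j k   = balanced-step zero zero (suc C) i j k (s≤s z≤n)

balanced : ∀ a b c → Balanced a b c
balanced a b c = <-rec Goal induct (a + b + c) a b c refl
  where
  Goal : ℕ → Set
  Goal n = ∀ a b c → a + b + c ≡ n → Balanced a b c
  induct : ∀ n → (∀ {m} → m < n → Goal m) → Goal n
  induct _ rec a b c refl with last-digit a | last-digit b | last-digit c
  ... | A , i , refl | B , j , refl | C , k , refl =
    balanced-from-digits A B C i j k (λ a b c lt → rec lt a b c refl)

-- For a + b + c = 3m, subtract S₃(3m) = 3 S₃(m) + 3m.
balanced-3m : ∀ a b c m → a + b + c ≡ 3 * m → 2 * (S3 a + S3 b + S3 c) ≤ 2 * (3 * S3 m) + spread a b c
balanced-3m a b c m sum≡ = +-cancelʳ-≤ (2 * (3 * m)) _ _ (begin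
  2 * (S3 a + S3 b + S3 c) + 2 * (3 * m)       ≡⟨ *-distribˡ-+ 2 (S3 a + S3 b + S3 c) (3 * m) ⟨
  2 * (S3 a + S3 b + S3 c + 3 * m)             ≡⟨ cong (λ v → 2 * (S3 a + S3 b + S3 c + v)) sum≡ ⟨
  2 * (S3 a + S3 b + S3 c + (a + b + c))       ≤⟨ balanced a b c ⟩
  2 * S3 (a + b + c) + spread a b c            ≡⟨ cong (λ v → 2 * S3 v + spread a b c) sum≡ ⟩
  2 * S3 (3 * m) + spread a b c                ≡⟨ cong (λ v → 2 * v + spread a b c) (S3-triple m) ⟩
  2 * (3 * S3 m + 3 * m) + spread a b c        ≡⟨ regroup (3 * S3 m) (3 * m) (spread a b c) ⟩
  2 * (3 * S3 m) + spread a b c + 2 * (3 * m)  ∎)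
  where
  open ≤-Reasoning
  regroup : ∀ x y d → 2 * (x + y) + d ≡ 2 * x + d + 2 * y
  regroup = solve-∀

∣m+n-m∣≡n : ∀ m n → ∣ m + n - m ∣ ≡ n
∣m+n-m∣≡n m n = trans (∣-∣-comm (m + n) m) (∣m-m+n∣≡n m n)

corner : ∀ k l m → l ≤ k → k ≤ m →
  (m + k + l) + (m ∸ k) + (m ∸ l) ≡ 3 * m × spread (m + k + l) (m ∸ k) (m ∸ l) ≡ 2 * (2 * k + l)
corner k l m l≤k k≤m with m≤n⇒∃[o]m+o≡n l≤k
... | j , refl with m≤n⇒∃[o]m+o≡n k≤m
... | i , refl rewrite m+n∸m≡n (l + j) i | +-assoc l j i | m+n∸m≡n l (j + i) =
  sum-eq l j i , spread-eq
  where
  open ≡-Reasoning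
  sum-eq : ∀ l j i → l + (j + i) + (l + j) + l + i + (j + i) ≡ 3 * (l + (j + i))
  sum-eq = solve-∀
  top : ℕ
  top = l + (j + i) + (l + j) + l
  spread-eq : spread top i (j + i) ≡ 2 * (2 * (l + j) + l)
  spread-eq = begin
    ∣ top - i ∣ + ∣ i - j + i ∣ + ∣ top - j + i ∣
      ≡⟨ cong₂ _+_ (cong₂ _+_ (cong ∣_- i ∣ (shape₁ l j i)) (cong ∣ i -_∣ (+-comm j i))) (cong ∣_- j + i ∣ (shape₂ l j i)) ⟩
    ∣ i + (3 * l + 2 * j) - i ∣ + ∣ i - i + j ∣ + ∣ j + i + (3 * l + j) - j + i ∣
      ≡⟨ cong₂ _+_ (cong₂ _+_ (∣m+n-m∣≡n i _) (∣m-m+n∣≡n i j)) (∣m+n-m∣≡n (j + i) _) ⟩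
    3 * l + 2 * j + j + (3 * l + j)
      ≡⟨ total l j ⟩
    2 * (2 * (l + j) + l) ∎
    where
    shape₁ : ∀ l j i → l + (j + i) + (l + j) + l ≡ i + (3 * l + 2 * j)
    shape₁ = solve-∀
    shape₂ : ∀ l j i → l + (j + i) + (l + j) + l ≡ j + i + (3 * l + j)
    shape₂ = solve-∀
    total : ∀ l j → 3 * l + 2 * j + j + (3 * l + j) ≡ 2 * (2 * (l + j) + l)
    total = solve-∀

digit-sum-bound : ∀ k l m → l ≤ k → k ≤ m →
  S3 (m + k + l) + S3 (m ∸ k) + S3 (m ∸ l) ≤ 3 * S3 m + (2 * k + l)
digit-sum-bound k l m l≤k k≤m = *-cancelˡ-≤ 2 (begin
  2 * (S3 (m + k + l) + S3 (m ∸ k) + S3 (m ∸ l))          ≤⟨ balanced-3m (m + k + l) (m ∸ k) (m ∸ l) m (proj₁ (corner k l m l≤k k≤m)) ⟩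
  2 * (3 * S3 m) + spread (m + k + l) (m ∸ k) (m ∸ l)    ≡⟨ cong (_+_ (2 * (3 * S3 m))) (proj₂ (corner k l m l≤k k≤m)) ⟩
  2 * (3 * S3 m) + 2 * (2 * k + l)                        ≡⟨ *-distribˡ-+ 2 (3 * S3 m) (2 * k + l) ⟨
  2 * (3 * S3 m + (2 * k + l))                            ∎)
  where open ≤-Reasoning

to-ℤ : ∀ x y z s w → x + y + z ≤ 3 * s + w → ((+ x +ℤ + y) +ℤ + z) -ℤ (+ 3) *ℤ (+ s) ≤ℤ + w
to-ℤ x y z s w bound = begin
  ((+ x +ℤ + y) +ℤ + z) -ℤ (+ 3) *ℤ (+ s) ≡⟨ cong (+ (x + y + z) -ℤ_) (ℤ.pos-* 3 s) ⟨
  + (x + y + z) -ℤ + (3 * s)              ≡⟨ ℤ.m-n≡m⊖n (x + y + z) (3 * s) ⟩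
  (x + y + z) ⊖ (3 * s)                   ≤⟨ ℤ.⊖-monoˡ-≤ (3 * s) bound ⟩
  (3 * s + w) ⊖ (3 * s)                   ≡⟨ ℤ.⊖-≥ (m≤m+n (3 * s) w) ⟩
  + (3 * s + w ∸ 3 * s)                   ≡⟨ cong +_ (m+n∸m≡n (3 * s) w) ⟩
  + w                                     ∎
  where open ℤ.≤-Reasoning

theorem2 : ∀ (k l m : ℕ) → l ≤ k → k ≤ m →
    ((+ S3 (m + k + l) +ℤ + S3 (m ∸ k)) +ℤ + S3 (m ∸ l)) -ℤ (+ 3) *ℤ (+ S3 m)
      ≤ℤ (+ 2) *ℤ (+ k) +ℤ (+ l)
theorem2 k l m l≤k k≤m = subst (λ w → lhs ≤ℤ w) (cong (_+ℤ + l) (ℤ.pos-* 2 k))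
  (to-ℤ (S3 (m + k + l)) (S3 (m ∸ k)) (S3 (m ∸ l)) (S3 m) (2 * k + l) (digit-sum-bound k l m l≤k k≤m))
  where
  lhs : ℤ
  lhs = ((+ S3 (m + k + l) +ℤ + S3 (m ∸ k)) +ℤ + S3 (m ∸ l)) -ℤ (+ 3) *ℤ (+ S3 m)
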